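{- Let $D$ be a finite twin-free digraph having at least one pair of symmetric arcs (arcs $\overrightarrow{uv}$ and $\overrightarrow{vu}$ both present). Then $\overrightarrow{\gamma^{\mathrm{ID}}}(D)\le |V(D)|-1$.
   Context: Digraphs have no loops or multiple arcs. For a vertex $u$, $B_1^+(u)$ is the set consisting of $u$ and all $w$ with an arc from $w$ to $u$. Vertices $u\neq v$ are twins if $B_1^+(u)=B_1^+(v)$; $D$ is twin-free if it has no twins. An identifying code of $D$ is a set $C\subseteq V(D)$ such that $B_1^+(u)\cap C\neq\emptyset$ for all $u$ and $B_1^+(u)\cap C\neq B_1^+(v)\cap C$ for all distinct $u,v$; $\overrightarrow{\gamma^{\mathrm{ID}}}(D)$ is the minimum size of an identifying code. -}

module Defs where

open import Data.Nat using (ℕ; _∸_; _≤_)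
open import Data.Fin using (Fin)
open import Data.Bool using (Bool; true)
open import Data.Fin.Subset using (Subset; _∈_; ∣_∣)
open import Data.Product using (Σ; _×_; ∃-syntax)
open import Data.Sum using (_⊎_)
open import Data.Empty using (⊥)
open import Relation.Nullary using (¬_)
open import Relation.Binary.PropositionalEquality using (_≡_)
open import Function.Bundles using (_⇔_)

-- Being a relation, there are no
-- multiple arcs; loops are excluded by the field no-loop.
record Digraph (n : ℕ) : Set where
  field
    arc     : Fin n → Fin n → Bool
    no-loop : ∀ u → ¬ (arc u u ≡ true)
open Digraph public

Arc : ∀ {n} → Digraph n → Fin n → Fin n → Set
Arc D u v = arc D u v ≡ true

InBall : ∀ {n} → Digraph n → Fin n → Fin n → Set
InBall D u w = (w ≡ u) ⊎ Arc D w u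

Twins : ∀ {n} → Digraph n → Fin n → Fin n → Set
Twins D u v = ¬ (u ≡ v) × (∀ w → InBall D u w ⇔ InBall D v w)

TwinFree : ∀ {n} → Digraph n → Set
TwinFree D = ∀ u v → ¬ Twins D u v

HasSymmetricPair : ∀ {n} → Digraph n → Set
HasSymmetricPair D = ∃[ u ] ∃[ v ] (Arc D u v × Arc D v u)

InBallCode : ∀ {n} → Digraph n → Subset n → Fin n → Fin n → Set
InBallCode D C u w = (w ∈ C) × InBall D u w

IsIdentifyingCode : ∀ {n} → Digraph n → Subset n → Set
IsIdentifyingCode {n} D C =
  (∀ u → ∃[ w ] InBallCode D C u w) ×
  (∀ u v → ¬ (u ≡ v) → ¬ (∀ w → InBallCode D C u w ⇔ InBallCode D C v w))

IDNumber≤ : ∀ {n} → Digraph n → ℕ → Set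
IDNumber≤ {n} D k = ∃[ C ] (IsIdentifyingCode D C × ∣ C ∣ ≤ k)

-- If some vertex x has an in-neighbour and no two balls B₁⁺(u), B₁⁺(v) differ
-- exactly in x, then V ∖ {x} is an identifying code.  Otherwise every x yields an
-- edge in direction x between two of the n + 1 points ∅, B₁⁺(u) of the cube
-- {0,1}ⁿ.  As in Bondy's theorem, n + 1 points with one edge in every direction
-- form a tree, so any two are joined by a walk using each direction at most once;
-- such a walk from B₁⁺(u) down to ∅ only removes elements.  Hence every ball is a
-- smaller ball (or ∅) plus one element, which forces D to be transitive, and then
-- a pair of symmetric arcs u ⇄ v makes u and v twins.
module Submission where

open import Defs
open import Data.Nat using (ℕ; zero; suc; _∸_; _+_; _≤_; _<_; z≤n; s≤s)
open import Data.Nat.Properties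
  using (≤-refl; ≤-trans; ≤-reflexive; <⇒≤; <-irrefl; +-suc; +-identityʳ; +-monoˡ-≤; +-cancelʳ-≤; m<n⇒m<1+n)
open import Data.Fin using (Fin; zero; suc; toℕ; fromℕ<)
open import Data.Fin.Properties using (_≟_; any?; all?; toℕ-fromℕ<)
open import Data.Fin.Subset using (Subset; ⊤; ∁; ⁅_⁆; _-_; ∣_∣; _∈_)
open import Data.Fin.Subset.Properties
  using (∈⊤; ∣⊤∣≡n; x∈p∧x≢y⇒x∈p-y; x∈p⇒∣p-x∣<∣p∣; x∉p⇒x∈∁p; x≢y⇒x∉⁅y⁆; ∣∁p∣≡n∸∣p∣; ∣⁅x⁆∣≡1)
open import Data.Bool using (Bool; true; false)
open import Data.Bool.Properties using (⇔→≡; T-≡) renaming (_≟_ to _≟ᵇ_)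
open import Data.List using (List; []; _∷_; _++_)
open import Data.List.Membership.Propositional using (_∉_) renaming (_∈_ to _∈ˡ_)
open import Data.List.Relation.Unary.Any using (here; there)
open import Data.List.Relation.Unary.All as All using (All; []; _∷_)
open import Data.List.Relation.Unary.All.Properties using (All¬⇒¬Any) renaming (++⁺ to All-++⁺)
open import Data.List.Relation.Unary.AllPairs using ([]; _∷_)
open import Data.List.Relation.Unary.Unique.Propositional using (Unique)
open import Data.List.Relation.Unary.Unique.Propositional.Properties using () renaming (++⁺ to Unique-++⁺)
open import Data.Product using (Σ; _×_; _,_; proj₁; proj₂; ∃-syntax)
open import Data.Sum using (_⊎_; inj₁; inj₂)
open import Data.Empty using (⊥-elim)
open import Function using (_∘_)
open import Relation.Nullary using (¬_; Dec; yes; no; contradiction)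
open import Relation.Nullary.Decidable using (⌊_⌋; map′; _×-dec_; _→-dec_; _⊎-dec_; ¬?; toWitness; fromWitness)
open import Relation.Binary.PropositionalEquality using (_≡_; _≢_; refl; sym; trans; cong; subst)
open import Function.Bundles using (_⇔_; mk⇔; Equivalence)

_⊆ᵇ_ : ∀ {n} → (Fin n → Bool) → (Fin n → Bool) → Set
p ⊆ᵇ q = ∀ i → p i ≡ true → q i ≡ true

record Insertion {n} (x : Fin n) (small big : Fin n → Bool) : Set where
  constructor insertion
  field
    inserted  : big x ≡ true
    absent    : small x ≡ false
    unchanged : ∀ i → i ≢ x → big i ≡ small i
open Insertion

insertion? : ∀ {n} (x : Fin n) small big → Dec (Insertion x small big)
insertion? x small big =
  map′ (λ (i , a , u) → insertion i a u) (λ (insertion i a u) → i , a , u)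
    ((big x ≟ᵇ true) ×-dec (small x ≟ᵇ false) ×-dec all? λ i → ¬? (i ≟ x) →-dec (big i ≟ᵇ small i))

insertion-⊆ : ∀ {n} {x : Fin n} {small big} → Insertion x small big → small ⊆ᵇ big
insertion-⊆ {x = x} ins i small-i with i ≟ x
... | yes refl = inserted ins
... | no i≢x   = trans (unchanged ins i i≢x) small-i

record Edge {m n} (S : Fin m → Fin n → Bool) (x : Fin n) : Set where
  field
    top bottom : Fin m
    splits     : Insertion x (S bottom) (S top)

∣p∣≤1⇒x≡y : ∀ {m} {p : Subset m} {x y} → ∣ p ∣ ≤ 1 → x ∈ p → y ∈ p → x ≡ y
∣p∣≤1⇒x≡y {p = p} {x} {y} ∣p∣≤1 x∈p y∈p with x ≟ y
... | yes x≡y = x≡y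
... | no x≢y  = contradiction (≤-trans 2≤∣p∣ ∣p∣≤1) λ { (s≤s ()) }
  where
    2≤∣p∣ : 2 ≤ ∣ p ∣
    2≤∣p∣ = ≤-trans (s≤s (≤-trans (s≤s z≤n) (x∈p⇒∣p-x∣<∣p∣ (x∈p∧x≢y⇒x∈p-y y∈p (x≢y ∘ sym)))))
                    (x∈p⇒∣p-x∣<∣p∣ x∈p)

module CubeTree {n : ℕ} (S : Fin (suc n) → Fin n → Bool) (edge : ∀ x → Edge S x) where

  Node : Set
  Node = Fin (suc n)

  t b : Fin n → Node
  t x = Edge.top (edge x)
  b x = Edge.bottom (edge x)

  split : ∀ x → Insertion x (S (b x)) (S (t x))
  split x = Edge.splits (edge x)

  data Walk : Node → Node → Set where
    []   : ∀ {N} → Walk N N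
    down : ∀ {N M} x → N ≡ t x → Walk (b x) M → Walk N M
    up   : ∀ {N M} x → N ≡ b x → Walk (t x) M → Walk N M

  labels : ∀ {N M} → Walk N M → List (Fin n)
  labels []           = []
  labels (down x _ w) = x ∷ labels w
  labels (up x _ w)   = x ∷ labels w

  _++ʷ_ : ∀ {N M P} → Walk N M → Walk M P → Walk N P
  []           ++ʷ w = w
  down x e v   ++ʷ w = down x e (v ++ʷ w)
  up x e v     ++ʷ w = up x e (v ++ʷ w)

  labels-++ʷ : ∀ {N M P} (v : Walk N M) (w : Walk M P) → labels (v ++ʷ w) ≡ labels v ++ labels w
  labels-++ʷ []           w = refl
  labels-++ʷ (down x _ v) w = cong (x ∷_) (labels-++ʷ v w)
  labels-++ʷ (up x _ v)   w = cong (x ∷_) (labels-++ʷ v w)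

  walk-preserves : ∀ {N M x} (w : Walk N M) → x ∉ labels w → S N x ≡ S M x
  walk-preserves []              _  = refl
  walk-preserves (down y refl w) x∉ =
    trans (unchanged (split y) _ (x∉ ∘ here)) (walk-preserves w (x∉ ∘ there))
  walk-preserves (up y refl w)   x∉ =
    trans (sym (unchanged (split y) _ (x∉ ∘ here))) (walk-preserves w (x∉ ∘ there))

  record SimpleWalk (P : Fin n → Set) (N M : Node) : Set where
    constructor simple
    field
      walk     : Walk N M
      unique   : Unique (labels walk)
      labelled : All P (labels walk)

  ComponentEdge : ℕ → (Node → Node) → Node → Fin n → Set
  ComponentEdge k rep N ℓ = toℕ ℓ < k × rep (b ℓ) ≡ rep N

  -- Union–find state after inserting the edges in the directions 0, …, k − 1;
  -- every insertion merges two components, so at the end only one root is left.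
  record Forest (k : ℕ) : Set where
    field
      rep       : Node → Node
      roots     : Subset (suc n)
      rep∈roots : ∀ N → rep N ∈ roots
      few-roots : ∣ roots ∣ + k ≤ suc n
      path      : ∀ {N M} → rep N ≡ rep M → SimpleWalk (ComponentEdge k rep N) N M

  forest₀ : Forest 0
  forest₀ = record
    { rep       = λ N → N
    ; roots     = ⊤
    ; rep∈roots = λ _ → ∈⊤
    ; few-roots = ≤-reflexive (trans (+-identityʳ _) (∣⊤∣≡n (suc n)))
    ; path      = λ { refl → simple [] [] [] }
    }

  -- A walk inside one component never uses direction x, so it cannot join the
  -- ends of edge x, which differ at x.
  new-edge-joins-components : ∀ {k} (F : Forest k) x → toℕ x ≡ k →
    Forest.rep F (b x) ≢ Forest.rep F (t x)
  new-edge-joins-components F x toℕx≡k same =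
    contradiction (trans (sym (absent (split x))) (trans (walk-preserves walk x∉) (inserted (split x)))) λ ()
    where
      open SimpleWalk (Forest.path F same)
      x∉ : x ∉ labels walk
      x∉ = All¬⇒¬Any (All.map (λ (ℓ<k , _) x≡ℓ → <-irrefl (trans (cong toℕ (sym x≡ℓ)) toℕx≡k) ℓ<k) labelled)

  module Merge {k} (F : Forest k) (x : Fin n) (toℕx≡k : toℕ x ≡ k)
               (separate : Forest.rep F (b x) ≢ Forest.rep F (t x)) where
    open Forest F

    rb rt : Node
    rb = rep (b x)
    rt = rep (t x)

    relink : Node → Node
    relink c with c ≟ rb
    ... | yes _ = rt
    ... | no _  = c

    relink-rb : relink rb ≡ rt
    relink-rb with rb ≟ rb
    ... | yes _    = refl
    ... | no rb≢rb = contradiction refl rb≢rb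

    relink-other : ∀ {c} → c ≢ rb → relink c ≡ c
    relink-other {c} c≢rb with c ≟ rb
    ... | yes c≡rb = contradiction c≡rb c≢rb
    ... | no _     = refl

    rep′ : Node → Node
    rep′ N = relink (rep N)

    merged : rep′ (b x) ≡ rep′ (t x)
    merged = trans relink-rb (sym (relink-other (separate ∘ sym)))

    rep′∈roots′ : ∀ N → rep′ N ∈ roots - rb
    rep′∈roots′ N with rep N ≟ rb
    ... | yes _     = x∈p∧x≢y⇒x∈p-y (rep∈roots (t x)) (separate ∘ sym)
    ... | no N≢rb   = x∈p∧x≢y⇒x∈p-y (rep∈roots N) N≢rb

    few-roots′ : ∣ roots - rb ∣ + suc k ≤ suc n
    few-roots′ = ≤-trans (≤-reflexive (+-suc ∣ roots - rb ∣ k))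
                   (≤-trans (+-monoˡ-≤ k (x∈p⇒∣p-x∣<∣p∣ (rep∈roots (b x)))) few-roots)

    merged-cases : ∀ {N M} → rep′ N ≡ rep′ M →
      rep N ≡ rep M ⊎ (rep N ≡ rb × rep M ≡ rt) ⊎ (rep N ≡ rt × rep M ≡ rb)
    merged-cases {N} {M} eq with rep N ≟ rb | rep M ≟ rb
    ... | yes N∈rb | yes M∈rb = inj₁ (trans N∈rb (sym M∈rb))
    ... | yes N∈rb | no _     = inj₂ (inj₁ (N∈rb , sym eq))
    ... | no _     | yes M∈rb = inj₂ (inj₂ (eq , M∈rb))
    ... | no _     | no _     = inj₁ eq

    widen : ∀ {N ℓ} → ComponentEdge k rep N ℓ → ComponentEdge (suc k) rep′ N ℓ
    widen (ℓ<k , same) = m<n⇒m<1+n ℓ<k , cong relink same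

    -- Walk N ⇝ P, the single edge x from P to Q, then Q ⇝ M.  The two halves lie
    -- in different old components, so no direction repeats.
    bridge : ∀ {N M P Q} (step : Walk P Q) → labels step ≡ x ∷ [] →
      rep P ≢ rep Q → rep′ P ≡ rep′ Q → rep′ (b x) ≡ rep′ P →
      rep N ≡ rep P → rep Q ≡ rep M → SimpleWalk (ComponentEdge (suc k) rep′ N) N M
    bridge {N} {M} {P} {Q} step labels-step P≉Q P≈′Q bx≈′P N≈P Q≈M =
      simple (w₁ ++ʷ (step ++ʷ w₂))
             (subst Unique (sym labels-eq) (Unique-++⁺ u₁ (x∉w₂ ∷ u₂) disjoint))
             (subst (All (ComponentEdge (suc k) rep′ N)) (sym labels-eq)
                    (All-++⁺ (All.map widen l₁) (x-edge ∷ All.map from-Q l₂)))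
      where
        open SimpleWalk (path N≈P) renaming (walk to w₁; unique to u₁; labelled to l₁)
        open SimpleWalk (path Q≈M) renaming (walk to w₂; unique to u₂; labelled to l₂)

        labels-eq : labels (w₁ ++ʷ (step ++ʷ w₂)) ≡ labels w₁ ++ x ∷ labels w₂
        labels-eq = trans (labels-++ʷ w₁ _)
                          (cong (labels w₁ ++_) (trans (labels-++ʷ step w₂) (cong (_++ labels w₂) labels-step)))

        old : ∀ {ℓ} → toℕ ℓ < k → x ≢ ℓ
        old ℓ<k x≡ℓ = <-irrefl (trans (cong toℕ (sym x≡ℓ)) toℕx≡k) ℓ<k

        x∉w₂ : All (x ≢_) (labels w₂)
        x∉w₂ = All.map (λ (ℓ<k , _) → old ℓ<k) l₂

        disjoint : ∀ {ℓ} → ¬ (ℓ ∈ˡ labels w₁ × ℓ ∈ˡ x ∷ labels w₂)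
        disjoint (ℓ∈w₁ , here refl)  = old (proj₁ (All.lookup l₁ ℓ∈w₁)) refl
        disjoint (ℓ∈w₁ , there ℓ∈w₂) =
          P≉Q (trans (sym N≈P) (trans (sym (proj₂ (All.lookup l₁ ℓ∈w₁))) (proj₂ (All.lookup l₂ ℓ∈w₂))))

        x-edge : ComponentEdge (suc k) rep′ N x
        x-edge = ≤-reflexive (cong suc toℕx≡k) , trans bx≈′P (cong relink (sym N≈P))

        from-Q : ∀ {ℓ} → ComponentEdge k rep Q ℓ → ComponentEdge (suc k) rep′ N ℓ
        from-Q (ℓ<k , same) = m<n⇒m<1+n ℓ<k , trans (cong relink same) (trans (sym P≈′Q) (cong relink (sym N≈P)))

    path′ : ∀ {N M} → rep′ N ≡ rep′ M → SimpleWalk (ComponentEdge (suc k) rep′ N) N M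
    path′ eq with merged-cases eq
    ... | inj₁ same = let simple w u l = path same in simple w u (All.map widen l)
    ... | inj₂ (inj₁ (N∈rb , M∈rt)) =
      bridge (up x refl []) refl separate merged refl N∈rb (sym M∈rt)
    ... | inj₂ (inj₂ (N∈rt , M∈rb)) =
      bridge (down x refl []) refl (separate ∘ sym) (sym merged) merged N∈rt (sym M∈rb)

    forest′ : Forest (suc k)
    forest′ = record
      { rep       = rep′
      ; roots     = roots - rb
      ; rep∈roots = rep′∈roots′
      ; few-roots = few-roots′
      ; path      = path′
      }

  forest : ∀ k → k ≤ n → Forest k
  forest zero    _   = forest₀
  forest (suc k) k<n = Merge.forest′ F x x≡k (new-edge-joins-components F x x≡k)
    where
      F = forest k (<⇒≤ k<n)
      x = fromℕ< k<n
      x≡k = toℕ-fromℕ< k<n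

  connected : ∀ N M → Σ (Walk N M) (Unique ∘ labels)
  connected N M = walk , unique
    where
      open Forest (forest n ≤-refl)
      open SimpleWalk (path (∣p∣≤1⇒x≡y (+-cancelʳ-≤ n ∣ roots ∣ 1 few-roots) (rep∈roots N) (rep∈roots M)))

  data Descent : Node → Node → Set where
    []   : ∀ {N} → Descent N N
    down : ∀ {N M} x → N ≡ t x → Descent (b x) M → Descent N M

  -- An up-step in direction x is never undone, so it would put x into S M ⊆ S N,
  -- although N is its lower end.
  descend : ∀ {N M} (w : Walk N M) → Unique (labels w) → S M ⊆ᵇ S N → Descent N M
  descend []              _           _   = []
  descend {M = M} (down x refl w) (x∉w ∷ u) M⊆N = down x refl (descend w u M⊆bx)
    where
      M⊆bx : S M ⊆ᵇ S (b x)
      M⊆bx i Mi with i ≟ x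
      ... | yes refl = trans (walk-preserves w (All¬⇒¬Any x∉w)) Mi
      ... | no i≢x   = trans (sym (unchanged (split x) i i≢x)) (M⊆N i Mi)
  descend (up x refl w)   (x∉w ∷ _) M⊆N =
    contradiction (trans (sym (absent (split x)))
                         (M⊆N x (trans (sym (walk-preserves w (All¬⇒¬Any x∉w))) (inserted (split x))))) λ ()

module _ {n : ℕ} (D : Digraph n) where

  inBall? : ∀ u w → Dec (InBall D u w)
  inBall? u w = (w ≟ u) ⊎-dec (arc D w u ≟ᵇ true)

  ball : Fin n → Fin n → Bool
  ball u w = ⌊ inBall? u w ⌋

  ball-sound : ∀ {u w} → ball u w ≡ true → InBall D u w
  ball-sound = toWitness ∘ Equivalence.from T-≡

  ball-complete : ∀ {u w} → InBall D u w → ball u w ≡ true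
  ball-complete = Equivalence.to T-≡ ∘ fromWitness

  ball-self : ∀ u → ball u u ≡ true
  ball-self u = ball-complete (inj₁ refl)

  ⊆ᵇ⇒twins : ∀ {u v} → u ≢ v → ball u ⊆ᵇ ball v → ball v ⊆ᵇ ball u → Twins D u v
  ⊆ᵇ⇒twins u≢v u⊆v v⊆u = u≢v , λ w →
    mk⇔ (ball-sound ∘ u⊆v w ∘ ball-complete) (ball-sound ∘ v⊆u w ∘ ball-complete)

  HasInNeighbour : Fin n → Set
  HasInNeighbour x = ∃[ w ] Arc D w x

  Critical : Fin n → Set
  Critical x = ∃[ u ] ∃[ v ] Insertion x (ball v) (ball u)

  Removable : Fin n → Set
  Removable x = HasInNeighbour x × ¬ Critical x

  hasInNeighbour? : ∀ x → Dec (HasInNeighbour x)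
  hasInNeighbour? x = any? λ w → arc D w x ≟ᵇ true

  critical? : ∀ x → Dec (Critical x)
  critical? x = any? λ u → any? λ v → insertion? x (ball v) (ball u)

  removable? : ∀ x → Dec (Removable x)
  removable? x = hasInNeighbour? x ×-dec ¬? (critical? x)

  differ-only-at⇒critical : ∀ {x u v} → ball u x ≢ ball v x →
    (∀ w → w ≢ x → ball u w ≡ ball v w) → Critical x
  differ-only-at⇒critical {x} {u} {v} differ agree with ball u x in ux | ball v x in vx
  ... | true  | false = u , v , insertion ux vx agree
  ... | false | true  = v , u , insertion vx ux (λ w w≢x → sym (agree w w≢x))
  ... | true  | true  = contradiction refl differ
  ... | false | false = contradiction refl differ

  removable⇒code : TwinFree D → ∀ {x} → Removable x → IsIdentifyingCode D (∁ ⁅ x ⁆)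
  removable⇒code twin-free {x} (x-has , x-noncritical) = dominating , separating
    where
      C = ∁ ⁅ x ⁆

      ∈C : ∀ {w} → w ≢ x → w ∈ C
      ∈C w≢x = x∉p⇒x∈∁p (x≢y⇒x∉⁅y⁆ w≢x)

      dominating : ∀ u → ∃[ w ] InBallCode D C u w
      dominating u with u ≟ x
      ... | no u≢x   = u , ∈C u≢x , inj₁ refl
      ... | yes refl = let (w , w→x) = x-has in w , ∈C (λ { refl → no-loop D w w→x }) , inj₂ w→x

      agree-off-x : ∀ {u v} → (∀ w → InBallCode D C u w ⇔ InBallCode D C v w) →
        ∀ w → w ≢ x → ball u w ≡ ball v w
      agree-off-x same w w≢x = ⇔→≡ (mk⇔
        (λ uw → ball-complete (proj₂ (Equivalence.to (same w) (∈C w≢x , ball-sound uw))))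
        (λ vw → ball-complete (proj₂ (Equivalence.from (same w) (∈C w≢x , ball-sound vw)))))

      separating : ∀ u v → u ≢ v → ¬ (∀ w → InBallCode D C u w ⇔ InBallCode D C v w)
      separating u v u≢v same with ball u x ≟ᵇ ball v x
      ... | no differ = x-noncritical (differ-only-at⇒critical differ (agree-off-x same))
      ... | yes at-x  = twin-free u v (⊆ᵇ⇒twins u≢v (λ w → subst (_≡ true) (equal w))
                                                  (λ w → subst (_≡ true) (sym (equal w))))
        where
          equal : ∀ w → ball u w ≡ ball v w
          equal w with w ≟ x
          ... | yes refl = at-x
          ... | no w≢x   = agree-off-x same w w≢x

  ∣∁⁅x⁆∣≡n∸1 : ∀ x → ∣ ∁ ⁅ x ⁆ ∣ ≡ n ∸ 1
  ∣∁⁅x⁆∣≡n∸1 x = trans (∣∁p∣≡n∸∣p∣ ⁅ x ⁆) (cong (n ∸_) (∣⁅x⁆∣≡1 x))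

  -- The points of the cube: zero is ∅ and suc u is B₁⁺(u).
  ball⁰ : Fin (suc n) → Fin n → Bool
  ball⁰ zero    _ = false
  ball⁰ (suc u) = ball u

  edge-at : ∀ x → ¬ Removable x → Edge ball⁰ x
  edge-at x not-removable with hasInNeighbour? x
  ... | no source = record { top = suc x ; bottom = zero ; splits = insertion (ball-self x) refl only-x }
    where
      only-x : ∀ i → i ≢ x → ball x i ≡ false
      only-x i i≢x with inBall? x i
      ... | no _              = refl
      ... | yes (inj₁ i≡x)    = contradiction i≡x i≢x
      ... | yes (inj₂ i→x)    = contradiction (i , i→x) source
  ... | yes x-has with critical? x
  ...   | yes (u , v , ins)  = record { top = suc u ; bottom = suc v ; splits = ins }
  ...   | no x-noncritical   = ⊥-elim (not-removable (x-has , x-noncritical))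

  Closed : (Fin n → Bool) → Set
  Closed p = ∀ z → p z ≡ true → ball z ⊆ᵇ p

  -- u must be the inserted vertex x: otherwise u ∈ p, and closedness would put x ∈ p.
  insertion-closed : ∀ {x u p} → Closed p → Insertion x p (ball u) → Closed (ball u)
  insertion-closed {x} {u} {p} p-closed ins z uz y zy with z ≟ x
  ... | yes z≡x = subst (λ c → ball c y ≡ true) (trans z≡x (sym u≡x)) zy
    where
      u≡x : u ≡ x
      u≡x with u ≟ x
      ... | yes u≡x = u≡x
      ... | no u≢x  = contradiction
        (trans (sym (absent ins)) (p-closed u (trans (sym (unchanged ins u u≢x)) (ball-self u)) x (inserted ins)))
        λ ()
  ... | no z≢x = insertion-⊆ ins y (p-closed z (trans (sym (unchanged ins z z≢x)) uz) y zy)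

  module _ (edge : ∀ x → Edge ball⁰ x) where
    open CubeTree ball⁰ edge

    top-closed : ∀ x → Closed (ball⁰ (b x)) → Closed (ball⁰ (t x))
    top-closed x bottom-closed with Edge.top (edge x) | Edge.splits (edge x)
    ... | zero  | insertion () _ _
    ... | suc u | ins = insertion-closed bottom-closed ins

    descent-closed : ∀ {N} → Descent N zero → Closed (ball⁰ N)
    descent-closed []              = λ _ ()
    descent-closed (down x refl d) = top-closed x (descent-closed d)

    transitive : ∀ u → Closed (ball u)
    transitive u = descent-closed (descend walk unique λ _ ())
      where
        open Σ (connected (suc u) zero) renaming (proj₁ to walk; proj₂ to unique)

    no-symmetric-pair : TwinFree D → ¬ HasSymmetricPair D
    no-symmetric-pair twin-free (u , v , u→v , v→u) =
      twin-free u v (⊆ᵇ⇒twins u≢v (transitive v u (ball-complete (inj₂ u→v)))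
                                  (transitive u v (ball-complete (inj₂ v→u))))
      where
        u≢v : u ≢ v
        u≢v refl = no-loop D u u→v

corollary1 : (n : ℕ) (D : Digraph n) → TwinFree D → HasSymmetricPair D →
    IDNumber≤ D (n ∸ 1)
corollary1 n D twin-free symmetric with any? (removable? D)
... | yes (x , x-removable) =
  ∁ ⁅ x ⁆ , removable⇒code D twin-free x-removable , ≤-reflexive (∣∁⁅x⁆∣≡n∸1 D x)
... | no none =
  ⊥-elim (no-symmetric-pair D (λ x → edge-at D x (λ r → none (x , r))) twin-free symmetric)
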